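{- Let $S$ be any connected unpseudoknotted secondary structure of $c=\mathcal{O}(1)$ strands with $N$ total bases and strand ordering $\pi$. Then the number of unique symmetric backbone cuts (i.e. the total, over all divisors $R\neq 1$ of $v(\pi)$, of the number of distinct sets $\mathcal{C}_R^b$) is $\frac{N-c}{v(\pi)}\left[\sigma(v(\pi))-v(\pi)\right]=\mathcal{O}(N)$, where $\sigma(m)$ denotes the sum of the divisors of $m$.
   Context: Strands are words over $\{\mathrm{A},\mathrm{C},\mathrm{G},\mathrm{T}\}$; strands with identical sequences have the same strand type. A circular strand ordering $\pi$ is viewed as a cyclic string over strand types; $v(\pi)$ is the largest $n$ such that $\pi=y^n$ for a prefix $y$, and the shortest such prefix $x$ (with $x^{v(\pi)}=\pi$) is the fundamental component. The strand $X^n_m$ is the $m$-th strand of type $X$ in the $n$-th copy of $x$. Bases are placed around a circle in the order $\pi$, each strand $5'\to3'$. A covalent bond is a backbone bond between two consecutive bases $i,i+1$ of the same strand (there are $N-c$ of them; gaps between strands, called nicks, are not covalent bonds). Let $\rho$ be the rotation sending each base $i$ of strand $X^n_m$ to base $i$ of $X^{n+1 \bmod v(\pi)}_m$, and $G^\pi=\langle\rho\rangle$, cyclic of order $v(\pi)$. For a covalent bond $b$ between bases $i,i+1$ of strand $A^n_m$ and $R$ dividing $v(\pi)$, with $H$ the unique subgroup of $G^\pi$ of order $R$, the $R$-symmetric backbone cut generated by $b$ is $\mathcal{C}^b_R=\{a(b): a\in H\}$. -}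

module Defs where

open import Data.Nat using (ℕ; zero; suc; _+_; _*_; _∸_; _<_; _≤_; _/_; _%_; NonZero)
open import Data.Nat.Properties using (_<?_) renaming (_≟_ to _≟ℕ_)
open import Data.Nat.Divisibility using (_∣_; _∣?_)
open import Data.Bool using (Bool)
open import Data.Bool.Properties using () renaming (_≟_ to _≟𝔹_)
open import Data.Nat.ListAction using (sum)
open import Data.List using (List; []; _∷_; length; map; concat; replicate; upTo; filter; zipWith; any; deduplicate; concatMap)
import Data.List.Properties as LP
open import Data.List.Relation.Unary.Any using (Any) renaming (any? to anyDec)
open import Data.List.Membership.Propositional using (_∈_)
open import Data.Sum using (_⊎_)
open import Data.Product using (_×_; _,_; ∃; ∃-syntax; proj₁; proj₂)
import Data.Product.Properties as PP
open import Relation.Binary.PropositionalEquality using (_≡_)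
open import Relation.Nullary using (¬_; yes; no; ¬?; does)
open import Relation.Nullary.Decidable using (_×-dec_)

data Nucleotide : Set where
  A C G T : Nucleotide

-- A strand is its base sequence (5' → 3'); strands with equal
-- sequences have the same strand type.
Strand : Set
Strand = List Nucleotide

-- A (circular) strand ordering, given by a linear representative:
-- position j (0 ≤ j < c) holds the j-th strand going around the circle.
Ordering : Set
Ordering = List Strand

pow : ∀ {X : Set} → ℕ → List X → List X
pow n y = concat (replicate n y)

IsPower : Ordering → ℕ → Set
IsPower π n = ∃[ y ] π ≡ pow n y

IsV : Ordering → ℕ → Set
IsV π v = IsPower π v × (∀ n → IsPower π n → n ≤ v)

numStrands : Ordering → ℕ
numStrands = length

numBases : Ordering → ℕ
numBases π = sum (map length π)

strandOf : Ordering → ℕ → ℕ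
strandOf [] i = 0
strandOf (s ∷ ss) i with i <? length s
... | yes _ = 0
... | no  _ = suc (strandOf ss (i ∸ length s))

BasePair : Set
BasePair = ℕ × ℕ

IsSecondaryStructure : Ordering → List BasePair → Set
IsSecondaryStructure π S =
  (∀ {p} → p ∈ S → proj₁ p < proj₂ p × proj₂ p < numBases π)
  × (∀ {p q} → p ∈ S → q ∈ S →
       (proj₁ p ≡ proj₁ q ⊎ proj₁ p ≡ proj₂ q ⊎ proj₂ p ≡ proj₁ q ⊎ proj₂ p ≡ proj₂ q)
       → p ≡ q)

Unpseudoknotted : List BasePair → Set
Unpseudoknotted S =
  ∀ {p q} → p ∈ S → q ∈ S →
    ¬ (proj₁ p < proj₁ q × proj₁ q < proj₂ p × proj₂ p < proj₂ q)

data Linked (π : Ordering) (S : List BasePair) : ℕ → ℕ → Set where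
  here  : ∀ {j} → Linked π S j j
  fwd   : ∀ {j p} → p ∈ S → Linked π S j (strandOf π (proj₁ p))
          → Linked π S j (strandOf π (proj₂ p))
  bwd   : ∀ {j p} → p ∈ S → Linked π S j (strandOf π (proj₂ p))
          → Linked π S j (strandOf π (proj₁ p))

Connected : Ordering → List BasePair → Set
Connected π S = ∀ j k → j < numStrands π → k < numStrands π → Linked π S j k

-- a covalent bond (j , i): between bases i and i+1 of the strand at
-- position j (0 ≤ i, i + 1 < length of that strand)
Bond : Set
Bond = ℕ × ℕ

allBonds : Ordering → List Bond
allBonds π =
  concat (zipWith (λ j s → map (j ,_) (upTo (length s ∸ 1))) (upTo (length π)) π)

-- ρ^k : rotates the strand position by k·|x|, x the fundamental component
-- (|x| = c / v); base index within the strand is unchanged.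
rot : (π : Ordering) (v : ℕ) → .{{NonZero v}} → .{{NonZero (length π)}} → ℕ → Bond → Bond
rot π v k (j , i) = ((j + k * (length π / v)) % length π , i)

-- the R-symmetric backbone cut generated by b: orbit of b under the
-- subgroup H = ⟨ρ^{v/R}⟩ of order R
cut : (π : Ordering) (v R : ℕ) → .{{NonZero v}} → .{{NonZero R}} → .{{NonZero (length π)}}
      → Bond → List Bond
cut π v R b = map (λ t → rot π v ((v / R) * t) b) (upTo R)

_∈?ᵇ_ : Bond → List Bond → Bool
b ∈?ᵇ X = does (anyDec (λ b' → PP.≡-dec _≟ℕ_ _≟ℕ_ b b') X)

-- the set of bonds in X, as its characteristic vector over all bonds
-- (a canonical representation of X as a set)
asSet : Ordering → List Bond → List Bool
asSet π X = map (_∈?ᵇ X) (allBonds π)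

numDistinctCuts : (π : Ordering) (v R : ℕ) → .{{NonZero v}} → .{{NonZero R}} → .{{NonZero (length π)}} → ℕ
numDistinctCuts π v R =
  length (deduplicate (LP.≡-dec _≟𝔹_) (map (λ b → asSet π (cut π v R b)) (allBonds π)))

-- total over all divisors R ≠ 1 of v (R = suc r ranges over 1 … v)
totalSymmetricCuts : (π : Ordering) (v : ℕ) → .{{NonZero v}} → .{{NonZero (length π)}} → ℕ
totalSymmetricCuts π v =
  sum (map (λ r → numDistinctCuts π v (suc r))
           (filter (λ r → (suc r ∣? v) ×-dec ¬? (r ≟ℕ 0)) (upTo v)))

σ : ℕ → ℕ
σ m = sum (filter (_∣? m) (map suc (upTo m)))

-- Write π = yᵛ and, for R ∣ v, let D = c / R = (v / R)·|y|.  The rotation ρ^(v/R) moves every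
-- strand D positions along, so the R-symmetric cut generated by the bond (j , i) is exactly the
-- set of bonds (j′ , i) with j′ ≡ j (mod D).  Hence the bonds on the first D strands, i.e. the
-- bonds of y^(v/R), represent each such cut exactly once, and there are (v / R)·(N − c)/v of them.
-- Summing over the divisors R ≠ 1 of v, and using that d ↦ v / d permutes the divisors of v,
-- gives (N − c)/v · (σ(v) − v).
module Submission where

open import Defs
open import Data.Nat using (ℕ; zero; suc; pred; ≢-nonZero⁻¹; _+_; _*_; _∸_; _/_; _%_; _<_; _≤_; z<s; NonZero; >-nonZero)
open import Data.Nat.Properties
open import Data.Nat.DivMod
open import Data.Nat.Divisibility using (_∣_; _∣?_; divides; ∣⇒≤; m/n∣m; 0∣⇒≡0)
open import Data.Nat.ListAction using (sum)
open import Data.Nat.ListAction.Properties using (sum-↭)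
open import Data.Bool using (Bool; true)
open import Data.Bool.Properties using () renaming (_≟_ to _≟𝔹_)
open import Data.List using (List; []; _∷_; length; map; concat; zipWith; upTo; applyUpTo; filter; _++_; deduplicate)
import Data.List.Properties as LP
import Data.Product.Properties as PP
open import Data.List.Relation.Unary.All using (All; []; _∷_)
import Data.List.Relation.Unary.All as All
import Data.List.Relation.Unary.All.Properties as AllP
open import Data.List.Relation.Unary.Any using (here; there)
open import Data.List.Relation.Unary.Unique.Propositional using (Unique; []; _∷_)
import Data.List.Relation.Unary.Unique.Propositional.Properties as Unique
open import Data.List.Relation.Unary.Unique.DecPropositional.Properties using (deduplicate-!)
open import Data.List.Membership.Propositional using (_∈_)
open import Data.List.Membership.DecPropositional (PP.≡-dec _≟_ _≟_) using (_∈?_)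
open import Data.List.Membership.Propositional.Properties
open import Data.List.Membership.Propositional.Properties.WithK using (unique∧set⇒bag)
open import Data.List.Relation.Binary.BagAndSetEquality using (∼bag⇒↭)
open import Data.List.Relation.Binary.Permutation.Propositional using (_↭_)
open import Data.List.Relation.Binary.Permutation.Propositional.Properties using (↭-length)
open import Data.Product using (_×_; _,_; ∃-syntax; proj₁; proj₂; map₁)
open import Data.Sum using (inj₁; inj₂)
open import Data.Empty using (⊥)
open import Function using (id; _∘_; case_of_; _⇔_; mk⇔; Equivalence)
open import Relation.Binary.Definitions using (DecidableEquality)
open import Relation.Nullary using (yes; no; does; ¬?; contradiction)
open import Relation.Nullary.Decidable using (_×-dec_; dec-true; dec-false; does-⇔; decidable-stable)
open import Relation.Unary using (Decidable)
open import Relation.Binary.PropositionalEquality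
open ≡-Reasoning
open import Data.Nat.Solver using (module +-*-Solver)
open +-*-Solver

private
  variable
    X Z : Set

Unique-map⁺ : {f : X → Z} {xs : List X} → Unique xs →
  (∀ {x y} → x ∈ xs → y ∈ xs → f x ≡ f y → x ≡ y) → Unique (map f xs)
Unique-map⁺ [] inj = []
Unique-map⁺ (x∉xs ∷ xs!) inj =
  AllP.map⁺ (All.tabulate λ y∈ fx≡fy → All.lookup x∉xs y∈ (inj (here refl) (there y∈) fx≡fy))
  ∷ Unique-map⁺ xs! (λ x∈ y∈ → inj (there x∈) (there y∈))

unique∧⇔⇒↭ : {xs ys : List X} → Unique xs → Unique ys →
  (∀ {z} → z ∈ xs ⇔ z ∈ ys) → xs ↭ ys
unique∧⇔⇒↭ xs! ys! xs⇔ys = ∼bag⇒↭ (unique∧set⇒bag xs! ys! xs⇔ys)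

length-deduplicate-map : (_≟ᴮ_ : DecidableEquality Z) (f : X → Z) {xs ws : List X} →
  Unique ws → (∀ {w} → w ∈ ws → w ∈ xs) →
  (∀ {x} → x ∈ xs → ∃[ w ] w ∈ ws × f x ≡ f w) →
  (∀ {w w′} → w ∈ ws → w′ ∈ ws → f w ≡ f w′ → w ≡ w′) →
  length (deduplicate _≟ᴮ_ (map f xs)) ≡ length ws
length-deduplicate-map _≟ᴮ_ f {xs} {ws} ws! ws⊆xs represent inj =
  trans (↭-length dedup↭) (LP.length-map f ws)
  where
  dedup⊆ : ∀ {z} → z ∈ deduplicate _≟ᴮ_ (map f xs) → z ∈ map f ws
  dedup⊆ z∈ with x , x∈ , refl ← ∈-map⁻ f (Equivalence.from (deduplicate-∈⇔ _≟ᴮ_) z∈)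
    with w , w∈ , fx≡fw ← represent x∈ = subst (_∈ map f ws) (sym fx≡fw) (∈-map⁺ f w∈)
  ⊆dedup : ∀ {z} → z ∈ map f ws → z ∈ deduplicate _≟ᴮ_ (map f xs)
  ⊆dedup z∈ with w , w∈ , refl ← ∈-map⁻ f z∈ = Equivalence.to (deduplicate-∈⇔ _≟ᴮ_) (∈-map⁺ f (ws⊆xs w∈))
  dedup↭ : deduplicate _≟ᴮ_ (map f xs) ↭ map f ws
  dedup↭ = unique∧⇔⇒↭ (deduplicate-! _≟ᴮ_ (map f xs)) (Unique-map⁺ ws! inj) (mk⇔ dedup⊆ ⊆dedup)

strandBonds : ℕ → Strand → List Bond
strandBonds j s = map (j ,_) (upTo (length s ∸ 1))

bondsFrom : ℕ → Ordering → List Bond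
bondsFrom j []       = []
bondsFrom j (s ∷ ss) = strandBonds j s ++ bondsFrom (suc j) ss

allBonds≡bondsFrom0 : ∀ π → allBonds π ≡ bondsFrom 0 π
allBonds≡bondsFrom0 π = numbered-from id 0 π (λ _ → refl)
  where
  numbered-from : ∀ (g : ℕ → ℕ) k ss → (∀ x → g x ≡ k + x) →
    concat (zipWith strandBonds (applyUpTo g (length ss)) ss) ≡ bondsFrom k ss
  numbered-from g k []       g≗k+ = refl
  numbered-from g k (s ∷ ss) g≗k+ =
    cong₂ _++_ (cong (λ j → strandBonds j s) (trans (g≗k+ 0) (+-identityʳ k)))
               (numbered-from (g ∘ suc) (suc k) ss (λ x → trans (g≗k+ (suc x)) (+-suc k x)))

bondsFrom-++ : ∀ k xs ys → bondsFrom k (xs ++ ys) ≡ bondsFrom k xs ++ bondsFrom (k + length xs) ys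
bondsFrom-++ k []       ys = cong (λ j → bondsFrom j ys) (sym (+-identityʳ k))
bondsFrom-++ k (x ∷ xs) ys = begin
  strandBonds k x ++ bondsFrom (suc k) (xs ++ ys)
    ≡⟨ cong (strandBonds k x ++_) (bondsFrom-++ (suc k) xs ys) ⟩
  strandBonds k x ++ (bondsFrom (suc k) xs ++ bondsFrom (suc k + length xs) ys)
    ≡⟨ cong (λ j → strandBonds k x ++ (bondsFrom (suc k) xs ++ bondsFrom j ys)) (sym (+-suc k (length xs))) ⟩
  strandBonds k x ++ (bondsFrom (suc k) xs ++ bondsFrom (k + suc (length xs)) ys)
    ≡⟨ LP.++-assoc (strandBonds k x) _ _ ⟨
  (strandBonds k x ++ bondsFrom (suc k) xs) ++ bondsFrom (k + suc (length xs)) ys ∎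

bondsFrom-+ : ∀ k l xs → bondsFrom (k + l) xs ≡ map (map₁ (k +_)) (bondsFrom l xs)
bondsFrom-+ k l []       = refl
bondsFrom-+ k l (s ∷ ss) = begin
  strandBonds (k + l) s ++ bondsFrom (suc (k + l)) ss
    ≡⟨ cong₂ _++_ (LP.map-∘ (upTo (length s ∸ 1))) (cong (λ j → bondsFrom j ss) (sym (+-suc k l))) ⟩
  map (map₁ (k +_)) (strandBonds l s) ++ bondsFrom (k + suc l) ss
    ≡⟨ cong (map (map₁ (k +_)) (strandBonds l s) ++_) (bondsFrom-+ k (suc l) ss) ⟩
  map (map₁ (k +_)) (strandBonds l s) ++ map (map₁ (k +_)) (bondsFrom (suc l) ss)
    ≡⟨ LP.map-++ (map₁ (k +_)) (strandBonds l s) _ ⟨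
  map (map₁ (k +_)) (strandBonds l s ++ bondsFrom (suc l) ss) ∎

bondsFrom-shift : ∀ k xs → bondsFrom k xs ≡ map (map₁ (k +_)) (bondsFrom 0 xs)
bondsFrom-shift k xs = trans (cong (λ j → bondsFrom j xs) (sym (+-identityʳ k))) (bondsFrom-+ k 0 xs)

∈-bondsFrom⁻ : ∀ {e} k xs → e ∈ bondsFrom k xs → k ≤ proj₁ e × proj₁ e < k + length xs
∈-bondsFrom⁻ {e} k (s ∷ ss) e∈ with ∈-++⁻ (strandBonds k s) e∈
... | inj₁ e∈s with _ , _ , refl ← ∈-map⁻ (k ,_) e∈s = ≤-refl , m<m+n k z<s
... | inj₂ e∈ss with k<j , j<k+1+n ← ∈-bondsFrom⁻ (suc k) ss e∈ss =
  <⇒≤ k<j , subst (proj₁ e <_) (sym (+-suc k (length ss))) j<k+1+n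

bondsFrom-unique : ∀ k xs → Unique (bondsFrom k xs)
bondsFrom-unique k []       = []
bondsFrom-unique k (s ∷ ss) =
  Unique.++⁺ (Unique.map⁺ (cong proj₂) (Unique.upTo⁺ _)) (bondsFrom-unique (suc k) ss) disjoint
  where
  disjoint : ∀ {e} → e ∈ strandBonds k s × e ∈ bondsFrom (suc k) ss → ⊥
  disjoint (e∈s , e∈ss) with _ , _ , refl ← ∈-map⁻ (k ,_) e∈s =
    <-irrefl refl (proj₁ (∈-bondsFrom⁻ (suc k) ss e∈ss))

-- Empty strands must be excluded: truncated subtraction gives them 0 ∸ 1 = 0 bonds rather than −1.
length-bondsFrom+length≡numBases : ∀ k xs → All (λ s → NonZero (length s)) xs →
  length (bondsFrom k xs) + length xs ≡ numBases xs
length-bondsFrom+length≡numBases k []       []             = refl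
length-bondsFrom+length≡numBases k (s ∷ ss) (s≢0 ∷ ss≢0) = begin
    length (strandBonds k s ++ bondsFrom (suc k) ss) + suc (length ss)
      ≡⟨ cong (_+ suc (length ss)) (LP.length-++ (strandBonds k s)) ⟩
    length (strandBonds k s) + length (bondsFrom (suc k) ss) + suc (length ss)
      ≡⟨ cong (λ n → n + length (bondsFrom (suc k) ss) + suc (length ss))
              (trans (LP.length-map _ (upTo (length s ∸ 1))) (LP.length-upTo _)) ⟩
    length s ∸ 1 + length (bondsFrom (suc k) ss) + suc (length ss)
      ≡⟨ shuffle (length s ∸ 1) (length (bondsFrom (suc k) ss)) (length ss) ⟩
    suc (length s ∸ 1) + (length (bondsFrom (suc k) ss) + length ss)
      ≡⟨ cong₂ _+_ (suc-pred (length s) {{s≢0}}) (length-bondsFrom+length≡numBases (suc k) ss ss≢0) ⟩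
    length s + numBases ss ∎
    where
    shuffle : ∀ a b c → a + b + suc c ≡ suc a + (b + c)
    shuffle = solve 3 (λ a b c → a :+ b :+ (con 1 :+ c) := con 1 :+ a :+ (b :+ c)) refl

length-allBonds : ∀ π → All (λ s → NonZero (length s)) π → length (allBonds π) ≡ numBases π ∸ numStrands π
length-allBonds π nonempty = begin
  length (allBonds π)                           ≡⟨ cong length (allBonds≡bondsFrom0 π) ⟩
  length (bondsFrom 0 π)                        ≡⟨ m+n∸n≡m _ (length π) ⟨
  length (bondsFrom 0 π) + length π ∸ length π  ≡⟨ cong (_∸ length π) (length-bondsFrom+length≡numBases 0 π nonempty) ⟩
  numBases π ∸ numStrands π ∎

pow-+ : ∀ m n (y : List X) → pow (m + n) y ≡ pow m y ++ pow n y
pow-+ zero    n y = refl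
pow-+ (suc m) n y = trans (cong (y ++_) (pow-+ m n y)) (sym (LP.++-assoc y (pow m y) _))

pow-* : ∀ m n (y : List X) → pow (m * n) y ≡ pow m (pow n y)
pow-* zero    n y = refl
pow-* (suc m) n y = trans (pow-+ n (m * n) y) (cong (pow n y ++_) (pow-* m n y))

length-pow : ∀ n (y : List X) → length (pow n y) ≡ n * length y
length-pow zero    y = refl
length-pow (suc n) y = trans (LP.length-++ y) (cong (length y +_) (length-pow n y))

length-bondsFrom-pow : ∀ n y → length (bondsFrom 0 (pow n y)) ≡ n * length (bondsFrom 0 y)
length-bondsFrom-pow zero    y = refl
length-bondsFrom-pow (suc n) y = begin
  length (bondsFrom 0 (y ++ pow n y))
    ≡⟨ cong length (bondsFrom-++ 0 y (pow n y)) ⟩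
  length (bondsFrom 0 y ++ bondsFrom (length y) (pow n y))
    ≡⟨ LP.length-++ (bondsFrom 0 y) ⟩
  length (bondsFrom 0 y) + length (bondsFrom (length y) (pow n y))
    ≡⟨ cong (λ bs → length (bondsFrom 0 y) + length bs) (bondsFrom-shift (length y) (pow n y)) ⟩
  length (bondsFrom 0 y) + length (map (map₁ (length y +_)) (bondsFrom 0 (pow n y)))
    ≡⟨ cong (length (bondsFrom 0 y) +_) (trans (LP.length-map _ (bondsFrom 0 (pow n y))) (length-bondsFrom-pow n y)) ⟩
  length (bondsFrom 0 y) + n * length (bondsFrom 0 y) ∎

∈-bondsFrom-pow⁺ : ∀ n .{{_ : NonZero n}} y {e} → e ∈ bondsFrom 0 y → e ∈ bondsFrom 0 (pow n y)
∈-bondsFrom-pow⁺ (suc n) y {e} e∈ = subst (e ∈_) (sym (bondsFrom-++ 0 y (pow n y))) (∈-++⁺ˡ e∈)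

∈-bondsFrom-pow⁻ : ∀ n y .{{_ : NonZero (length y)}} {e} →
  e ∈ bondsFrom 0 (pow n y) → (proj₁ e % length y , proj₂ e) ∈ bondsFrom 0 y
∈-bondsFrom-pow⁻ (suc n) y {e} e∈ with ∈-++⁻ (bondsFrom 0 y) (subst (e ∈_) (bondsFrom-++ 0 y (pow n y)) e∈)
... | inj₁ e∈y =
  subst (λ j → (j , proj₂ e) ∈ bondsFrom 0 y) (sym (m<n⇒m%n≡m (proj₂ (∈-bondsFrom⁻ 0 y e∈y)))) e∈y
... | inj₂ e∈rest with (j , i) , e′∈ , refl ← ∈-map⁻ (map₁ (length y +_)) (subst (e ∈_) (bondsFrom-shift (length y) (pow n y)) e∈rest) =
  subst (λ j′ → (j′ , i) ∈ bondsFrom 0 y) (sym (trans (cong (_% length y) (+-comm (length y) j)) ([m+n]%n≡m%n j (length y))))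
        (∈-bondsFrom-pow⁻ n y e′∈)

[m+kn]%o%n≡m%n : ∀ m k {n o} .{{_ : NonZero n}} .{{_ : NonZero o}} → n ∣ o → (m + k * n) % o % n ≡ m % n
[m+kn]%o%n≡m%n m k {n} {o} n∣o = trans (m∣n⇒o%n%m≡o%m n o (m + k * n) n∣o) ([m+kn]%n≡m%n m k n)

-- Witness k = (o / n + l ∸ m / n) mod l: then m + k·n and o + l·n differ by a multiple of l·n.
∃[m+kn]%c≡o : ∀ {m o c} l n .{{_ : NonZero n}} .{{_ : NonZero c}} → c ≡ l * n →
  m < c → o < c → o % n ≡ m % n → ∃[ k ] k < l × (m + k * n) % c ≡ o
∃[m+kn]%c≡o {m} {o} l n refl m<c o<c o≡m = K % l , m%n<n K l , (begin
  (m + K % l * n) % (l * n)                        ≡⟨ [m+kn]%n≡m%n _ (K / l) (l * n) ⟨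
  (m + K % l * n + K / l * (l * n)) % (l * n)      ≡⟨ cong (_% (l * n)) m+Kn≡m+[K%l]n+[K/l]ln ⟨
  (m + K * n) % (l * n)                            ≡⟨ cong (_% (l * n)) m+Kn≡o+ln ⟩
  (o + 1 * (l * n)) % (l * n)                      ≡⟨ [m+kn]%n≡m%n o 1 (l * n) ⟩
  o % (l * n)                                      ≡⟨ m<n⇒m%n≡m o<c ⟩
  o ∎)
  where
  instance _ = m*n≢0⇒m≢0 l
  a = m / n
  K = o / n + (l ∸ a)
  a+[l∸a]≡l : a + (l ∸ a) ≡ l
  a+[l∸a]≡l = m+[n∸m]≡n (<⇒≤ (m<n*o⇒m/o<n m<c))
  m+Kn≡o+ln : m + K * n ≡ o + 1 * (l * n)
  m+Kn≡o+ln = begin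
    m + K * n                                      ≡⟨ cong (_+ K * n) (m≡m%n+[m/n]*n m n) ⟩
    m % n + a * n + (o / n + (l ∸ a)) * n          ≡⟨ swap (m % n) a (o / n) (l ∸ a) n ⟩
    m % n + o / n * n + (a + (l ∸ a)) * n          ≡⟨ cong₂ (λ r s → r + o / n * n + s * n) (sym o≡m) a+[l∸a]≡l ⟩
    o % n + o / n * n + l * n                      ≡⟨ cong₂ _+_ (sym (m≡m%n+[m/n]*n o n)) (sym (+-identityʳ (l * n))) ⟩
    o + 1 * (l * n) ∎
    where
    swap : ∀ r a b s n → r + a * n + (b + s) * n ≡ r + b * n + (a + s) * n
    swap = solve 5 (λ r a b s n → r :+ a :* n :+ (b :+ s) :* n := r :+ b :* n :+ (a :+ s) :* n) refl
  m+Kn≡m+[K%l]n+[K/l]ln : m + K * n ≡ m + K % l * n + K / l * (l * n)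
  m+Kn≡m+[K%l]n+[K/l]ln = begin
    m + K * n                                      ≡⟨ cong (λ x → m + x * n) (m≡m%n+[m/n]*n K l) ⟩
    m + (K % l + K / l * l) * n                    ≡⟨ split m (K % l) (K / l) l n ⟩
    m + K % l * n + K / l * (l * n) ∎
    where
    split : ∀ m r q l n → m + (r + q * l) * n ≡ m + r * n + q * (l * n)
    split = solve 5 (λ m r q l n → m :+ (r :+ q :* l) :* n := m :+ r :* n :+ q :* (l :* n)) refl

asSet-cong : ∀ π {X Y : List Bond} → (∀ {e} → e ∈ X ⇔ e ∈ Y) → asSet π X ≡ asSet π Y
asSet-cong π {X} {Y} X⇔Y = LP.map-cong (λ b → does-⇔ X⇔Y (b ∈? X) (b ∈? Y)) (allBonds π)

asSet-≡⇒⊆ : ∀ π {X Y : List Bond} {b} → asSet π X ≡ asSet π Y → b ∈ allBonds π → b ∈ X → b ∈ Y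
asSet-≡⇒⊆ π {X} {Y} {b} X≡Y b∈ b∈X =
  decidable-stable (b ∈? Y) λ b∉Y → case trans (sym b∈?Y) (dec-false (b ∈? Y) b∉Y) of λ ()
  where
  pointwise : ∀ {f g : Bond → Bool} {bs} → map f bs ≡ map g bs → b ∈ bs → f b ≡ g b
  pointwise {bs = _ ∷ _} fbs≡gbs (here refl) = proj₁ (LP.∷-injective fbs≡gbs)
  pointwise {bs = _ ∷ _} fbs≡gbs (there b∈) = pointwise (proj₂ (LP.∷-injective fbs≡gbs)) b∈
  b∈?Y : does (b ∈? Y) ≡ true
  b∈?Y = trans (sym (pointwise X≡Y b∈)) (dec-true (b ∈? X) b∈X)

module PeriodicCuts (y : Ordering) (v R : ℕ) .{{_ : NonZero v}} .{{_ : NonZero R}}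
                   .{{c≢0 : NonZero (length (pow v y))}} (R∣v : R ∣ v) where

  π : Ordering
  π = pow v y

  c q D : ℕ
  c = length π
  q = v / R
  D = length (pow q y)

  π≡[yᵠ]ᴿ : π ≡ pow R (pow q y)
  π≡[yᵠ]ᴿ = trans (cong (λ n → pow n y) (sym (m*[n/m]≡n R∣v))) (pow-* R q y)

  c≡R*D : c ≡ R * D
  c≡R*D = trans (cong length π≡[yᵠ]ᴿ) (length-pow R (pow q y))

  instance
    D≢0 : NonZero D
    D≢0 = m*n≢0⇒n≢0 R {{subst NonZero c≡R*D c≢0}}

  D≤c : D ≤ c
  D≤c = subst (D ≤_) (sym c≡R*D) (m≤n*m D R)

  rot-step : ∀ t → q * t * (c / v) ≡ t * D
  rot-step t = begin
    q * t * (c / v)        ≡⟨ cong (q * t *_) (/-congˡ (trans (length-pow v y) (*-comm v (length y)))) ⟩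
    q * t * (length y * v / v) ≡⟨ cong (q * t *_) (m*n/n≡m (length y) v) ⟩
    q * t * length y       ≡⟨ cong (_* length y) (*-comm q t) ⟩
    t * q * length y       ≡⟨ *-assoc t q (length y) ⟩
    t * (q * length y)     ≡⟨ cong (t *_) (length-pow q y) ⟨
    t * D ∎

  cut≡shifts : ∀ j i → cut π v R (j , i) ≡ map (λ t → ((j + t * D) % c , i)) (upTo R)
  cut≡shifts j i = LP.map-cong (λ t → cong (λ x → ((j + x) % c , i)) (rot-step t)) (upTo R)

  ∈-cut⁻ : ∀ {j i e} → e ∈ cut π v R (j , i) → proj₂ e ≡ i × proj₁ e < c × proj₁ e % D ≡ j % D
  ∈-cut⁻ {j} {i} e∈ with t , _ , refl ← ∈-map⁻ _ (subst (_ ∈_) (cut≡shifts j i) e∈) =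
    refl , m%n<n _ c , [m+kn]%o%n≡m%n j t (divides R c≡R*D)

  ∈-cut⁺ : ∀ {j j′ i} → j < c → j′ < c → j′ % D ≡ j % D → (j′ , i) ∈ cut π v R (j , i)
  ∈-cut⁺ {j} {j′} {i} j<c j′<c j′≡j with t , t<R , j+tD≡j′ ← ∃[m+kn]%c≡o R D c≡R*D j<c j′<c j′≡j =
    subst (_ ∈_) (sym (cut≡shifts j i)) (subst (λ x → (x , i) ∈ _) j+tD≡j′ (∈-map⁺ _ (∈-upTo⁺ t<R)))

  cut-cong : ∀ {j j′ i} → j < c → j′ < c → j % D ≡ j′ % D → ∀ {e} → e ∈ cut π v R (j , i) ⇔ e ∈ cut π v R (j′ , i)
  cut-cong j<c j′<c j≡j′ = mk⇔ (move j′<c j≡j′) (move j<c (sym j≡j′))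
    where
    move : ∀ {j j′ i e} → j′ < c → j % D ≡ j′ % D → e ∈ cut π v R (j , i) → e ∈ cut π v R (j′ , i)
    move j′<c j≡j′ e∈ with refl , e<c , e≡j ← ∈-cut⁻ e∈ = ∈-cut⁺ j′<c e<c (trans e≡j j≡j′)

  cutSet : Bond → List Bool
  cutSet b = asSet π (cut π v R b)

  allBonds≡bonds[yᵠ]ᴿ : allBonds π ≡ bondsFrom 0 (pow R (pow q y))
  allBonds≡bonds[yᵠ]ᴿ = trans (allBonds≡bondsFrom0 π) (cong (bondsFrom 0) π≡[yᵠ]ᴿ)

  bond<c : ∀ {b} → b ∈ allBonds π → proj₁ b < c
  bond<c b∈ = proj₂ (∈-bondsFrom⁻ 0 π (subst (_ ∈_) (allBonds≡bondsFrom0 π) b∈))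

  ⊆allBonds : ∀ {w} → w ∈ bondsFrom 0 (pow q y) → w ∈ allBonds π
  ⊆allBonds w∈ = subst (_ ∈_) (sym allBonds≡bonds[yᵠ]ᴿ) (∈-bondsFrom-pow⁺ R (pow q y) w∈)

  ∈-cut-self : ∀ {b} → b ∈ allBonds π → b ∈ cut π v R b
  ∈-cut-self b∈ = ∈-cut⁺ (bond<c b∈) (bond<c b∈) refl

  representative : ∀ {b} → b ∈ allBonds π →
    ∃[ w ] w ∈ bondsFrom 0 (pow q y) × cutSet b ≡ cutSet w
  representative {j , i} b∈ =
    (j % D , i) , ∈-bondsFrom-pow⁻ R (pow q y) (subst (_ ∈_) allBonds≡bonds[yᵠ]ᴿ b∈) ,
    asSet-cong π (cut-cong (bond<c b∈) (<-≤-trans (m%n<n j D) D≤c) (sym (m%n%n≡m%n j D)))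

  cutSet-injective : ∀ {w w′} → w ∈ bondsFrom 0 (pow q y) → w′ ∈ bondsFrom 0 (pow q y) →
    cutSet w ≡ cutSet w′ → w ≡ w′
  cutSet-injective {j , i} {j′ , i′} w∈ w′∈ w≡w′
    with refl , _ , j≡j′ ← ∈-cut⁻ (asSet-≡⇒⊆ π w≡w′ (⊆allBonds w∈) (∈-cut-self (⊆allBonds w∈))) =
    cong (_, i) (begin
      j       ≡⟨ m<n⇒m%n≡m (proj₂ (∈-bondsFrom⁻ 0 (pow q y) w∈)) ⟨
      j % D   ≡⟨ j≡j′ ⟩
      j′ % D  ≡⟨ m<n⇒m%n≡m (proj₂ (∈-bondsFrom⁻ 0 (pow q y) w′∈)) ⟩
      j′ ∎)

  numDistinctCuts-pow : numDistinctCuts π v R ≡ q * length (bondsFrom 0 y)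
  numDistinctCuts-pow = begin
    numDistinctCuts π v R
      ≡⟨ length-deduplicate-map (LP.≡-dec _≟𝔹_) cutSet (bondsFrom-unique 0 (pow q y))
           ⊆allBonds
           representative cutSet-injective ⟩
    length (bondsFrom 0 (pow q y))
      ≡⟨ length-bondsFrom-pow q y ⟩
    q * length (bondsFrom 0 y) ∎

divisors : ℕ → List ℕ
divisors m = filter (_∣? m) (map suc (upTo m))

∈-divisors⁺ : ∀ {m d} .{{_ : NonZero m}} → d ∣ m → d ∈ divisors m
∈-divisors⁺ {m} {zero}  0∣m = contradiction (0∣⇒≡0 0∣m) (≢-nonZero⁻¹ m)
∈-divisors⁺ {m} {suc d} d∣m = ∈-filter⁺ (_∣? m) (∈-map⁺ suc (∈-upTo⁺ (∣⇒≤ d∣m))) d∣m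

quotient-nonZero : ∀ {m n} .{{_ : NonZero m}} .{{_ : NonZero n}} → n ∣ m → NonZero (m / n)
quotient-nonZero n∣m = >-nonZero (m≥n⇒m/n>0 (∣⇒≤ n∣m))

m/[m/n]≡n : ∀ {m n} .{{_ : NonZero n}} .{{_ : NonZero (m / n)}} → n ∣ m → m / (m / n) ≡ n
m/[m/n]≡n {m} {n} n∣m = trans (/-congˡ (sym (m*[n/m]≡n n∣m))) (m*n/n≡m n (m / n))

-- Indices r stand for the divisors 1 + r, so that v / (1 + r) needs no side condition.
divisorIndices : ℕ → List ℕ
divisorIndices v = filter (λ r → suc r ∣? v) (upTo v)

map-quotient↭divisors : ∀ v .{{_ : NonZero v}} → map (λ r → v / suc r) (divisorIndices v) ↭ divisors v
map-quotient↭divisors v = unique∧⇔⇒↭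
  (Unique-map⁺ (Unique.filter⁺ _ (Unique.upTo⁺ v)) quotient-injective)
  (Unique.filter⁺ _ (Unique.map⁺ suc-injective (Unique.upTo⁺ v)))
  (mk⇔ quotient∈divisors divisor∈quotients)
  where
  index∣ : ∀ {r} → r ∈ divisorIndices v → suc r ∣ v
  index∣ r∈ = proj₂ (∈-filter⁻ (λ r → suc r ∣? v) {xs = upTo v} r∈)

  quotient-injective : ∀ {r s} → r ∈ divisorIndices v → s ∈ divisorIndices v → v / suc r ≡ v / suc s → r ≡ s
  quotient-injective {r} {s} r∈ s∈ v/r≡v/s = suc-injective (begin
    suc r               ≡⟨ m/[m/n]≡n (index∣ r∈) ⟨
    v / (v / suc r)     ≡⟨ /-congʳ v/r≡v/s ⟩
    v / (v / suc s)     ≡⟨ m/[m/n]≡n (index∣ s∈) ⟩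
    suc s ∎)
    where instance _ = quotient-nonZero (index∣ r∈)
                   _ = quotient-nonZero (index∣ s∈)

  quotient∈divisors : ∀ {z} → z ∈ map (λ r → v / suc r) (divisorIndices v) → z ∈ divisors v
  quotient∈divisors z∈ with r , r∈ , refl ← ∈-map⁻ _ z∈ = ∈-divisors⁺ (m/n∣m (index∣ r∈))

  divisor∈quotients : ∀ {z} → z ∈ divisors v → z ∈ map (λ r → v / suc r) (divisorIndices v)
  divisor∈quotients z∈ with z∈′ , d∣v ← ∈-filter⁻ (_∣? v) {xs = map suc (upTo v)} z∈
    with d , _ , refl ← ∈-map⁻ suc z∈′ =
    subst (_∈ map (λ r → v / suc r) (divisorIndices v)) d≡v/r
          (∈-map⁺ (λ r → v / suc r) (∈-filter⁺ (λ r → suc r ∣? v) (∈-upTo⁺ (∣⇒≤ r∣v)) r∣v))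
    where
    instance _ = quotient-nonZero d∣v
    r = pred (v / suc d)
    r∣v : suc r ∣ v
    r∣v = subst (_∣ v) (sym (suc-pred (v / suc d))) (m/n∣m d∣v)
    d≡v/r : v / suc r ≡ suc d
    d≡v/r = trans (/-congʳ (suc-pred (v / suc d))) (m/[m/n]≡n d∣v)

filter-≐-∈ : ∀ {P Q : X → Set} (P? : Decidable P) (Q? : Decidable Q) {xs} →
  (∀ {x} → x ∈ xs → P x ⇔ Q x) → filter P? xs ≡ filter Q? xs
filter-≐-∈ P? Q? {[]}     P⇔Q = refl
filter-≐-∈ P? Q? {x ∷ xs} P⇔Q with Q? x
... | yes Qx = trans (LP.filter-accept P? (Equivalence.from (P⇔Q (here refl)) Qx))
                     (cong (x ∷_) (filter-≐-∈ P? Q? (P⇔Q ∘ there)))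
... | no ¬Qx = trans (LP.filter-reject P? (¬Qx ∘ Equivalence.to (P⇔Q (here refl))))
                     (filter-≐-∈ P? Q? (P⇔Q ∘ there))

sum-quotients-nontrivial : ∀ v .{{_ : NonZero v}} →
  sum (map (λ r → v / suc r) (filter (λ r → (suc r ∣? v) ×-dec ¬? (r ≟ 0)) (upTo v))) ≡ σ v ∸ v
sum-quotients-nontrivial v@(suc v′) = begin
  sum (map g (filter P? (upTo v)))              ≡⟨ m+n∸m≡n v _ ⟨
  v + sum (map g (filter P? (upTo v))) ∸ v      ≡⟨ cong (_∸ v) σ≡v+sum ⟨
  σ v ∸ v                                       ∎
  where
  g = λ r → v / suc r
  P? = λ r → (suc r ∣? v) ×-dec ¬? (r ≟ 0)
  Q? = λ r → suc r ∣? v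
  rest = applyUpTo suc v′

  nontrivial⇔ : ∀ {r} → r ∈ rest → (suc r ∣ v × r ≢ 0) ⇔ suc r ∣ v
  nontrivial⇔ r∈ with _ , _ , refl ← ∈-applyUpTo⁻ suc r∈ = mk⇔ proj₁ (_, λ ())

  σ≡v+sum : σ v ≡ v + sum (map g (filter P? (upTo v)))
  σ≡v+sum = begin
    σ v                                   ≡⟨ sum-↭ (map-quotient↭divisors v) ⟨
    sum (map g (divisorIndices v))        ≡⟨ cong (sum ∘ map g) (LP.filter-accept Q? (divides v (sym (*-identityʳ v)))) ⟩
    g 0 + sum (map g (filter Q? rest))    ≡⟨ cong₂ _+_ (n/1≡n v) (cong (sum ∘ map g) (sym (filter-≐-∈ P? Q? nontrivial⇔))) ⟩
    v + sum (map g (filter P? rest))      ≡⟨ cong (λ rs → v + sum (map g rs)) (LP.filter-reject P? (λ (_ , 0≢0) → 0≢0 refl)) ⟨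
    v + sum (map g (filter P? (upTo v)))  ∎

sum-map-*ʳ : ∀ (f : X → ℕ) n xs → sum (map (λ x → f x * n) xs) ≡ sum (map f xs) * n
sum-map-*ʳ f n []       = refl
sum-map-*ʳ f n (x ∷ xs) = trans (cong (f x * n +_) (sum-map-*ʳ f n xs)) (sym (*-distribʳ-+ n (f x) _))

length-bondsFrom≡[numBases∸numStrands]/v : ∀ v .{{_ : NonZero v}} y → All (λ s → NonZero (length s)) (pow v y) →
  length (bondsFrom 0 y) ≡ (numBases (pow v y) ∸ numStrands (pow v y)) / v
length-bondsFrom≡[numBases∸numStrands]/v v y nonempty = begin
  L                                       ≡⟨ m*n/n≡m L v ⟨
  L * v / v                               ≡⟨ /-congˡ (*-comm L v) ⟩
  v * L / v                               ≡⟨ /-congˡ (length-bondsFrom-pow v y) ⟨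
  length (bondsFrom 0 (pow v y)) / v      ≡⟨ /-congˡ (cong length (allBonds≡bondsFrom0 (pow v y))) ⟨
  length (allBonds (pow v y)) / v         ≡⟨ /-congˡ (length-allBonds (pow v y) nonempty) ⟩
  (numBases (pow v y) ∸ numStrands (pow v y)) / v ∎
  where L = length (bondsFrom 0 y)

lemma1 : (π : Ordering) → .{{_ : NonZero (length π)}}
    → All (λ s → NonZero (length s)) π
    → (S : List BasePair) → IsSecondaryStructure π S → Unpseudoknotted S → Connected π S
    → (v : ℕ) → .{{_ : NonZero v}} → IsV π v
    → totalSymmetricCuts π v ≡ ((numBases π ∸ numStrands π) / v) * (σ v ∸ v)
lemma1 _ nonempty _ _ _ _ v ((y , refl) , _) = begin
  sum (map (λ r → numDistinctCuts (pow v y) v (suc r)) Rs)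
    ≡⟨ cong sum (LP.map-cong-local (All.tabulate λ r∈ →
         PeriodicCuts.numDistinctCuts-pow y v _ (proj₁ (proj₂ (∈-filter⁻ P? {xs = upTo v} r∈))))) ⟩
  sum (map (λ r → v / suc r * L) Rs)      ≡⟨ sum-map-*ʳ (λ r → v / suc r) L Rs ⟩
  sum (map (λ r → v / suc r) Rs) * L      ≡⟨ cong (_* L) (sum-quotients-nontrivial v) ⟩
  (σ v ∸ v) * L                           ≡⟨ *-comm (σ v ∸ v) L ⟩
  L * (σ v ∸ v)                           ≡⟨ cong (_* (σ v ∸ v)) (length-bondsFrom≡[numBases∸numStrands]/v v y nonempty) ⟩
  ((numBases (pow v y) ∸ numStrands (pow v y)) / v) * (σ v ∸ v) ∎
  where
  P? = λ r → (suc r ∣? v) ×-dec ¬? (r ≟ 0)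
  Rs = filter P? (upTo v)
  L = length (bondsFrom 0 y)
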